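{- There is an absolute constant $c>0$ such that the following holds. Let $m,n\ge 2$, let $A$ be an $m\times n$ matrix (with distinct entries), let $\pi$ be an involution of $\{1,\dots,n\}$ with $k=a_2(\pi)$, and let $d\in\{\mathtt U,\mathtt D\}$. Then there is a sequence of at most $c\cdot(km+n)$ rotations, each a unit rightward rotation of the first row $R$ or a unit downward rotation of a column, whose net effect on $A$ is exactly: (i) for every $j\in\{1,\dots,n\}$, the element initially at $R[j]$ ends at $R[\pi(j)]$; and (ii) for each $j=1,\dots,k$, the body of $C_j$ undergoes a cyclic upward shift if $d=\mathtt U$ (the element at $C_j[i]$ moves to $C_j[i-1]$ for $3\le i\le m$, and the element at $C_j[2]$ moves to $C_j[m]$), respectively a cyclic downward shift if $d=\mathtt D$ (the element at $C_j[i]$ moves to $C_j[i+1]$ for $2\le i\le m-1$, and the element at $C_j[m]$ moves to $C_j[2]$); all other elements end in their initial positions.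
   Context: Rows and columns are numbered from $1$. $R$ denotes the first row and $C_j$ the $j$-th column; $R[j]$ and $C_j[i]$ denote the position at column $j$ of $R$, respectively at row $i$ of $C_j$; so $R[j]=C_j[1]$. The body of $C_j$ consists of positions $C_j[2],\dots,C_j[m]$. A unit rightward rotation of $R$ moves $R[j]$ to $R[j+1]$ for $j<n$ and $R[n]$ to $R[1]$; a unit downward rotation of $C_j$ moves $C_j[i]$ to $C_j[i+1]$ for $i<m$ and $C_j[m]$ to $C_j[1]$. An involution is a permutation $\pi$ with $\pi\circ\pi=\mathrm{id}$; $a_2(\pi)$ denotes the number of cycles of length $2$ of $\pi$. -}

module Defs where

open import Data.Nat using (ℕ; zero; suc; _+_; _*_; _<_; _%_)
open import Data.Nat.DivMod using (m%n<n)
open import Data.Fin using (Fin; zero; suc; toℕ; fromℕ<)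
import Data.Fin as F
open import Data.Fin.Properties using () renaming (_≟_ to _≟ᶠ_)
open import Data.List using (List; []; _∷_; length; filter; allFin)
open import Data.Product using (_×_; _,_)
open import Relation.Nullary using (does; Dec)
open import Relation.Nullary.Decidable using (_×-dec_)
open import Relation.Binary.PropositionalEquality using (_≡_)
open import Data.Bool using (if_then_else_)

-- Positions are 0-indexed: row index 0 is the first row R, column index j is C_{j+1}.

csuc : ∀ {k} → Fin (suc k) → Fin (suc k)
csuc {k} i = fromℕ< (m%n<n (suc (toℕ i)) (suc k))

cpred : ∀ {k} → Fin (suc k) → Fin (suc k)
cpred {k} i = fromℕ< (m%n<n (toℕ i + k) (suc k))

Matrix : Set → ℕ → ℕ → Set
Matrix X m n = Fin m → Fin n → X

data Move (n : ℕ) : Set where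
  rowR : Move n
  colD : Fin n → Move n

applyMove : ∀ {X m n} → Move (suc n) → Matrix X (suc m) (suc n) → Matrix X (suc m) (suc n)
applyMove rowR A zero j = A zero (cpred j)
applyMove rowR A (suc i) j = A (suc i) j
applyMove (colD c) A i j = if does (j ≟ᶠ c) then A (cpred i) j else A i j

run : ∀ {X m n} → List (Move (suc n)) → Matrix X (suc m) (suc n) → Matrix X (suc m) (suc n)
run [] A = A
run (x ∷ xs) A = run xs (applyMove x A)

Involution : ∀ {n} → (Fin n → Fin n) → Set
Involution π = ∀ j → π (π j) ≡ j

-- a₂(π): number of 2-cycles, each counted once via its smaller element
a2 : ∀ {n} → (Fin n → Fin n) → ℕ
a2 {n} π = length (filter (λ j → (j F.<? π j) ×-dec (π (π j) ≟ᶠ j)) (allFin n))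

data Dir : Set where
  U D : Dir

-- cyclic shift of the body (rows 2..m, i.e. indices 1..m-1) of a column:
-- where the element at row index i moves to
bodyShift : ∀ {m} → Dir → Fin (suc (suc m)) → Fin (suc (suc m))
bodyShift d zero = zero
bodyShift U (suc b) = suc (cpred b)
bodyShift D (suc b) = suc (csuc b)

target : ∀ {m n} → (Fin n → Fin n) → ℕ → Dir
       → Fin (suc (suc m)) × Fin n → Fin (suc (suc m)) × Fin n
target π k d (zero , j) = (zero , π j)
target π k d (suc i , j) = if does (toℕ j Data.Nat.<? k) then (bodyShift d (suc i) , j) else (suc i , j)

{-# OPTIONS --safe #-}

-- A sweep turns R once around (n unit rotations) and, at the moment the element of a
-- chosen row cell R[σ i] lies on top of column C_i, shifts that column by one step.
-- Its net effect is a one-step cyclic shift of each virtual column formed by R[σ i]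
-- above the body of C_i, every other cell being fixed, at a cost of at most n + k·m
-- moves. Assign the 2-cycles (s, π s), s < π s, of π to the first k columns and let
-- ρ_t be the shift of the virtual column topped by R[t]. Sweeping with tops s in
-- direction d, then with tops π s in the opposite direction, then again with tops s in
-- direction d acts on R[s], R[π s] and the body of C_i as ρ_s, then ρ_{π s}⁻¹, then
-- ρ_s; this exchanges the two row cells and shifts the body by one step, skipping the
-- top. Three sweeps cost at most 3(km + n).

module Submission where

open import Defs
open import Data.Bool using (if_then_else_; true; false)
open import Data.Empty using (⊥-elim)
open import Data.Fin as F using (Fin; zero; suc; toℕ; fromℕ<; inject≤)
open import Data.Fin.Properties
  using (toℕ-fromℕ<; toℕ-injective; toℕ<n; toℕ-inject≤; inject≤-injective)
  renaming (_≟_ to _≟ᶠ_)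
open import Data.List using (List; []; _∷_; _++_; length; filter; allFin; map; concatMap; replicate; lookup)
open import Data.List.Properties using (length-++; length-map; length-replicate; length-filter; length-tabulate)
open import Data.List.Membership.Propositional using (_∈_; _∉_)
open import Data.List.Membership.Propositional.Properties
  using (∈-filter⁺; ∈-filter⁻; ∈-allFin; ∈-map⁺; ∈-map⁻; ∈-lookup)
import Data.List.Relation.Unary.All as All
open import Data.List.Relation.Unary.AllPairs using (_∷_)
open import Data.List.Relation.Unary.Any using (here; there; index)
open import Data.List.Relation.Unary.Any.Properties using (lookup-index)
open import Data.List.Relation.Unary.Unique.Propositional using (Unique)
open import Data.List.Relation.Unary.Unique.Propositional.Properties
  using (map⁺; filter⁺; allFin⁺; Unique[x∷xs]⇒x∉xs)
open import Data.Nat using (ℕ; zero; suc; _+_; _*_; _∸_; _<_; _≤_; _%_; z≤n; s≤s; _≟_; _<?_; z<s; NonZero)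
open import Data.Nat.DivMod using (m%n<n; %-distribˡ-+; m%n%n≡m%n; [m+n]%n≡m%n; m<n⇒m%n≡m; n%n≡0)
open import Data.Nat.Properties
import Algebra.Properties.CommutativeSemigroup +-commutativeSemigroup as ℕ-CS
open import Data.Nat.Tactic.RingSolver using (solve-∀)
open import Data.Product using (Σ; _×_; _,_; proj₁; proj₂; uncurry)
open import Data.Sum using (_⊎_; inj₁; inj₂)
open import Function using (_∘_)
open import Relation.Binary.Definitions using (tri<; tri≈; tri>)
open import Relation.Binary.PropositionalEquality
open import Relation.Nullary using (Dec; does; yes; no; ¬_)
open import Relation.Nullary.Decidable using (_×-dec_; dec-true; dec-false)

[m+n%d]%d≡[m+n]%d : ∀ m n d .{{_ : NonZero d}} → (m + n % d) % d ≡ (m + n) % d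
[m+n%d]%d≡[m+n]%d m n d = begin
  (m + n % d) % d          ≡⟨ %-distribˡ-+ m (n % d) d ⟩
  (m % d + n % d % d) % d  ≡⟨ cong (λ x → (m % d + x) % d) (m%n%n≡m%n n d) ⟩
  (m % d + n % d) % d      ≡⟨ %-distribˡ-+ m n d ⟨
  (m + n) % d              ∎
  where open ≡-Reasoning

module _ {K : ℕ} where

  private
    N : ℕ
    N = suc K

  csucⁿ : ℕ → Fin N → Fin N
  csucⁿ zero    i = i
  csucⁿ (suc t) i = csuc (csucⁿ t i)

  toℕ-csuc : (i : Fin N) → toℕ (csuc i) ≡ suc (toℕ i) % N
  toℕ-csuc i = toℕ-fromℕ< _

  toℕ-cpred : (i : Fin N) → toℕ (cpred i) ≡ (toℕ i + K) % N
  toℕ-cpred i = toℕ-fromℕ< _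

  toℕ-csucⁿ : ∀ t (i : Fin N) → toℕ (csucⁿ t i) ≡ (toℕ i + t) % N
  toℕ-csucⁿ zero    i = sym (trans (cong (_% N) (+-identityʳ (toℕ i))) (m<n⇒m%n≡m (toℕ<n i)))
  toℕ-csucⁿ (suc t) i = begin
    toℕ (csuc (csucⁿ t i))     ≡⟨ toℕ-csuc (csucⁿ t i) ⟩
    suc (toℕ (csucⁿ t i)) % N  ≡⟨ cong (λ x → suc x % N) (toℕ-csucⁿ t i) ⟩
    (1 + (toℕ i + t) % N) % N  ≡⟨ [m+n%d]%d≡[m+n]%d 1 (toℕ i + t) N ⟩
    suc (toℕ i + t) % N        ≡⟨ cong (_% N) (+-suc (toℕ i) t) ⟨
    (toℕ i + suc t) % N        ∎
    where open ≡-Reasoning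

  csucⁿ-csuc : ∀ t (i : Fin N) → csucⁿ t (csuc i) ≡ csuc (csucⁿ t i)
  csucⁿ-csuc zero    i = refl
  csucⁿ-csuc (suc t) i = cong csuc (csucⁿ-csuc t i)

  csucⁿ-period : (i : Fin N) → csucⁿ N i ≡ i
  csucⁿ-period i = toℕ-injective (begin
    toℕ (csucⁿ N i)  ≡⟨ toℕ-csucⁿ N i ⟩
    (toℕ i + N) % N  ≡⟨ [m+n]%n≡m%n (toℕ i) N ⟩
    toℕ i % N        ≡⟨ m<n⇒m%n≡m (toℕ<n i) ⟩
    toℕ i            ∎)
    where open ≡-Reasoning

  cpred≡csucⁿ : (i : Fin N) → cpred i ≡ csucⁿ K i
  cpred≡csucⁿ i = toℕ-injective (trans (toℕ-cpred i) (sym (toℕ-csucⁿ K i)))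

  cpred-csuc : (i : Fin N) → cpred (csuc i) ≡ i
  cpred-csuc i = begin
    cpred (csuc i)    ≡⟨ cpred≡csucⁿ (csuc i) ⟩
    csucⁿ K (csuc i)  ≡⟨ csucⁿ-csuc K i ⟩
    csucⁿ N i         ≡⟨ csucⁿ-period i ⟩
    i                 ∎
    where open ≡-Reasoning

  csuc-cpred : (i : Fin N) → csuc (cpred i) ≡ i
  csuc-cpred i = trans (cong csuc (cpred≡csucⁿ i)) (csucⁿ-period i)

  csuc-injective : ∀ {i j : Fin N} → csuc i ≡ csuc j → i ≡ j
  csuc-injective {i} {j} eq = trans (sym (cpred-csuc i)) (trans (cong cpred eq) (cpred-csuc j))

  csucⁿ-injective : ∀ t {i j : Fin N} → csucⁿ t i ≡ csucⁿ t j → i ≡ j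
  csucⁿ-injective zero    eq = eq
  csucⁿ-injective (suc t) eq = csucⁿ-injective t (csuc-injective eq)

  toℕ-csuc-< : {i : Fin N} → toℕ i < K → toℕ (csuc i) ≡ suc (toℕ i)
  toℕ-csuc-< {i} i<K = trans (toℕ-csuc i) (m<n⇒m%n≡m (s≤s i<K))

  csuc-last : {i : Fin N} → toℕ i ≡ K → csuc i ≡ zero
  csuc-last {i} i≡K = toℕ-injective (trans (toℕ-csuc i) (trans (cong (λ x → suc x % N) i≡K) (n%n≡0 N)))

  toℕ-cpred-zero : toℕ (cpred (zero {K})) ≡ K
  toℕ-cpred-zero = trans (toℕ-cpred zero) (m<n⇒m%n≡m (n<1+n K))

  toℕ-cpred-suc : (i : Fin K) → toℕ (cpred (suc i)) ≡ toℕ i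
  toℕ-cpred-suc i = begin
    toℕ (cpred (suc i))   ≡⟨ toℕ-cpred (suc i) ⟩
    suc (toℕ i + K) % N   ≡⟨ cong (_% N) (+-suc (toℕ i) K) ⟨
    (toℕ i + N) % N       ≡⟨ [m+n]%n≡m%n (toℕ i) N ⟩
    toℕ i % N             ≡⟨ m<n⇒m%n≡m (m<n⇒m<1+n (toℕ<n i)) ⟩
    toℕ i                 ∎
    where open ≡-Reasoning

  gap : Fin N → Fin N → ℕ
  gap s j = (toℕ j + N ∸ toℕ s) % N

  gap<N : ∀ s j → gap s j < N
  gap<N s j = m%n<n (toℕ j + N ∸ toℕ s) N

  csucⁿ-gap : ∀ s j → csucⁿ (gap s j) s ≡ j
  csucⁿ-gap s j = toℕ-injective (begin
    toℕ (csucⁿ (gap s j) s)                  ≡⟨ toℕ-csucⁿ (gap s j) s ⟩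
    (toℕ s + (toℕ j + N ∸ toℕ s) % N) % N    ≡⟨ [m+n%d]%d≡[m+n]%d (toℕ s) _ N ⟩
    (toℕ s + (toℕ j + N ∸ toℕ s)) % N        ≡⟨ cong (_% N) (m+[n∸m]≡n s≤j+N) ⟩
    (toℕ j + N) % N                          ≡⟨ [m+n]%n≡m%n (toℕ j) N ⟩
    toℕ j % N                                ≡⟨ m<n⇒m%n≡m (toℕ<n j) ⟩
    toℕ j                                    ∎)
    where
      open ≡-Reasoning
      s≤j+N : toℕ s ≤ toℕ j + N
      s≤j+N = ≤-trans (<⇒≤ (toℕ<n s)) (m≤n+m N (toℕ j))

shift : ∀ {K} → Dir → Fin (suc K) → Fin (suc K)
shift D = csuc
shift U = cpred

opposite : Dir → Dir
opposite U = D
opposite D = U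

shift-inverseˡ : ∀ {K} d (i : Fin (suc K)) → shift (opposite d) (shift d i) ≡ i
shift-inverseˡ D = cpred-csuc
shift-inverseˡ U = csuc-cpred

shift-inverseʳ : ∀ {K} d (i : Fin (suc K)) → shift d (shift (opposite d) i) ≡ i
shift-inverseʳ D = csuc-cpred
shift-inverseʳ U = cpred-csuc

shift-zero≢zero : ∀ {K} d → shift d (zero {suc K}) ≢ zero
shift-zero≢zero {K} D eq = 1+n≢0 (trans (sym (toℕ-csuc-< {suc K} {zero} z<s)) (cong toℕ eq))
shift-zero≢zero U eq = 1+n≢0 (trans (sym toℕ-cpred-zero) (cong toℕ eq))

bodyShift≢zero : ∀ {m} d (b : Fin (suc m)) → bodyShift d (suc b) ≢ zero
bodyShift≢zero D b ()
bodyShift≢zero U b ()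

-- The body shift is the shift of the whole column with the top cell skipped.
bodyShift-skips-top : ∀ {m} d (b : Fin (suc m))
  → (shift d (suc b) ≡ zero × shift d zero ≡ bodyShift d (suc b)) ⊎ shift d (suc b) ≡ bodyShift d (suc b)
bodyShift-skips-top {m} D b with m≤n⇒m<n∨m≡n (≤-pred (toℕ<n b))
... | inj₁ b<m = inj₂ (toℕ-injective (trans (toℕ-csuc-< (s≤s b<m)) (cong suc (sym (toℕ-csuc-< b<m)))))
... | inj₂ b≡m = inj₁ (csuc-last (cong suc b≡m) , toℕ-injective (begin
  toℕ (csuc (zero {suc m}))  ≡⟨ toℕ-csuc-< {suc m} z<s ⟩
  1                          ≡⟨ cong (suc ∘ toℕ) (csuc-last b≡m) ⟨
  toℕ (suc (csuc b))         ∎))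
  where open ≡-Reasoning
bodyShift-skips-top U zero =
  inj₁ (toℕ-injective (toℕ-cpred-suc zero) , toℕ-injective (trans toℕ-cpred-zero (cong suc (sym toℕ-cpred-zero))))
bodyShift-skips-top U (suc b) =
  inj₂ (toℕ-injective (trans (toℕ-cpred-suc (suc b)) (cong suc (sym (toℕ-cpred-suc b)))))

Pos : ℕ → ℕ → Set
Pos m n = Fin (suc m) × Fin (suc n)

-- Where a move sends the element in a given cell (applyMove describes the
-- same move by where each cell reads its new element from).
dest : ∀ {m n} → Move (suc n) → Pos m n → Pos m n
dest rowR     (zero  , j) = zero , csuc j
dest rowR     (suc i , j) = suc i , j
dest (colD c) (i     , j) = if does (j ≟ᶠ c) then (csuc i , j) else (i , j)

dests : ∀ {m n} → List (Move (suc n)) → Pos m n → Pos m n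
dests []       p = p
dests (x ∷ xs) p = dests xs (dest x p)

dests-++ : ∀ {m n} xs ys (p : Pos m n) → dests (xs ++ ys) p ≡ dests ys (dests xs p)
dests-++ []       ys p = refl
dests-++ (x ∷ xs) ys p = dests-++ xs ys (dest x p)

module _ {m n : ℕ} {i : Fin (suc m)} where

  dest-colD-same : ∀ (j : Fin (suc n)) → dest (colD j) (i , j) ≡ (csuc i , j)
  dest-colD-same j rewrite dec-true (j ≟ᶠ j) refl = refl

  dest-colD-other : ∀ {j c : Fin (suc n)} → j ≢ c → dest (colD c) (i , j) ≡ (i , j)
  dest-colD-other {j} {c} j≢c rewrite dec-false (j ≟ᶠ c) j≢c = refl

  applyMove-colD-same : ∀ {X} (A : Matrix X (suc m) (suc n)) j → applyMove (colD j) A i j ≡ A (cpred i) j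
  applyMove-colD-same A j rewrite dec-true (j ≟ᶠ j) refl = refl

  applyMove-colD-other : ∀ {X} (A : Matrix X (suc m) (suc n)) {j c} → j ≢ c → applyMove (colD c) A i j ≡ A i j
  applyMove-colD-other A {j} {c} j≢c rewrite dec-false (j ≟ᶠ c) j≢c = refl

applyMove-dest : ∀ {X m n} x (A : Matrix X (suc m) (suc n)) p → uncurry (applyMove x A) (dest x p) ≡ uncurry A p
applyMove-dest rowR     A (zero  , j) = cong (A zero) (cpred-csuc j)
applyMove-dest rowR     A (suc i , j) = refl
applyMove-dest (colD c) A (i     , j) with j ≟ᶠ c
... | yes refl = trans (applyMove-colD-same A j) (cong (λ r → A r j) (cpred-csuc i))
... | no  j≢c  = applyMove-colD-other A j≢c

run-dests : ∀ {X m n} ms (A : Matrix X (suc m) (suc n)) p → uncurry (run ms A) (dests ms p) ≡ uncurry A p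
run-dests []       A p = refl
run-dests (x ∷ xs) A p = trans (run-dests xs (applyMove x A) (dest x p)) (applyMove-dest x A p)

module _ {m n : ℕ} where

  rotate : ℕ → Pos m n → Pos m n
  rotate zero    p = p
  rotate (suc t) p = dest rowR (rotate t p)

  rotate-top : ∀ t s → rotate t (zero , s) ≡ (zero , csucⁿ t s)
  rotate-top zero    s = refl
  rotate-top (suc t) s rewrite rotate-top t s = refl

  rotate-body : ∀ t b j → rotate t (suc b , j) ≡ (suc b , j)
  rotate-body zero    b j = refl
  rotate-body (suc t) b j rewrite rotate-body t b j = refl

  rotate-period : ∀ p → rotate (suc n) p ≡ p
  rotate-period (zero  , s) = trans (rotate-top (suc n) s) (cong (zero ,_) (csucⁿ-period s))
  rotate-period (suc b , j) = rotate-body (suc n) b j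

-- Only downward column rotations are available: m of them rotate a column of
-- height m + 1 upwards.
colOp : ∀ {n} → ℕ → Dir → Fin (suc n) → List (Move (suc n))
colOp m D j = colD j ∷ []
colOp m U j = replicate m (colD j)

length-colOp : ∀ {n} m d (j : Fin (suc n)) → length (colOp m d j) ≤ suc m
length-colOp m D j = s≤s z≤n
length-colOp m U j = ≤-trans (≤-reflexive (length-replicate m)) (n≤1+n m)

module _ {m n : ℕ} where

  dests-replicate-colD : ∀ t j (r : Fin (suc m)) → dests {m} {n} (replicate t (colD j)) (r , j) ≡ (csucⁿ t r , j)
  dests-replicate-colD zero    j r = refl
  dests-replicate-colD (suc t) j r = begin
    dests (replicate t (colD j)) (dest (colD j) (r , j))  ≡⟨ cong (dests (replicate t (colD j))) (dest-colD-same j) ⟩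
    dests (replicate t (colD j)) (csuc r , j)             ≡⟨ dests-replicate-colD t j (csuc r) ⟩
    (csucⁿ t (csuc r) , j)                                ≡⟨ cong (_, j) (csucⁿ-csuc t r) ⟩
    (csuc (csucⁿ t r) , j)                                ∎
    where open ≡-Reasoning

  dests-replicate-colD-other : ∀ t {j c} (r : Fin (suc m)) → j ≢ c → dests {m} {n} (replicate t (colD c)) (r , j) ≡ (r , j)
  dests-replicate-colD-other zero    r j≢c = refl
  dests-replicate-colD-other (suc t) r j≢c =
    trans (cong (dests (replicate t _)) (dest-colD-other j≢c)) (dests-replicate-colD-other t r j≢c)

  dests-colOp-same : ∀ d j (r : Fin (suc m)) → dests {m} {n} (colOp m d j) (r , j) ≡ (shift d r , j)
  dests-colOp-same D j r = dest-colD-same j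
  dests-colOp-same U j r = trans (dests-replicate-colD m j r) (cong (_, j) (sym (cpred≡csucⁿ r)))

  dests-colOp-other : ∀ d {j c} (r : Fin (suc m)) → j ≢ c → dests {m} {n} (colOp m d c) (r , j) ≡ (r , j)
  dests-colOp-other D r j≢c = dest-colD-other j≢c
  dests-colOp-other U r j≢c = dests-replicate-colD-other m r j≢c

  dests-colOps-∉ : ∀ d {cs j} (r : Fin (suc m)) → j ∉ cs → dests {m} {n} (concatMap (colOp m d) cs) (r , j) ≡ (r , j)
  dests-colOps-∉ d {[]}     r j∉cs = refl
  dests-colOps-∉ d {c ∷ cs} r j∉cs = begin
    dests (colOp m d c ++ concatMap (colOp m d) cs) (r , _)  ≡⟨ dests-++ (colOp m d c) _ _ ⟩
    dests (concatMap (colOp m d) cs) (dests (colOp m d c) (r , _))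
      ≡⟨ cong (dests (concatMap (colOp m d) cs)) (dests-colOp-other d r (j∉cs ∘ here)) ⟩
    dests (concatMap (colOp m d) cs) (r , _)  ≡⟨ dests-colOps-∉ d r (j∉cs ∘ there) ⟩
    (r , _)                                   ∎
    where open ≡-Reasoning

  dests-colOps-∈ : ∀ d {cs j} (r : Fin (suc m)) → Unique cs → j ∈ cs
    → dests {m} {n} (concatMap (colOp m d) cs) (r , j) ≡ (shift d r , j)
  dests-colOps-∈ d {c ∷ cs} r u (here refl) = begin
    dests (colOp m d c ++ concatMap (colOp m d) cs) (r , c)  ≡⟨ dests-++ (colOp m d c) _ _ ⟩
    dests (concatMap (colOp m d) cs) (dests (colOp m d c) (r , c))
      ≡⟨ cong (dests (concatMap (colOp m d) cs)) (dests-colOp-same d c r) ⟩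
    dests (concatMap (colOp m d) cs) (shift d r , c)  ≡⟨ dests-colOps-∉ d (shift d r) (Unique[x∷xs]⇒x∉xs u) ⟩
    (shift d r , c)                                   ∎
    where open ≡-Reasoning
  dests-colOps-∈ d {c ∷ cs} r (c∉cs ∷ u) (there j∈cs) = begin
    dests (colOp m d c ++ concatMap (colOp m d) cs) (r , _)  ≡⟨ dests-++ (colOp m d c) _ _ ⟩
    dests (concatMap (colOp m d) cs) (dests (colOp m d c) (r , _))
      ≡⟨ cong (dests (concatMap (colOp m d) cs)) (dests-colOp-other d r (λ j≡c → All.lookup c∉cs j∈cs (sym j≡c))) ⟩
    dests (concatMap (colOp m d) cs) (r , _)  ≡⟨ dests-colOps-∈ d r u j∈cs ⟩
    (shift d r , _)                           ∎
    where open ≡-Reasoning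

length-concatMap-≤ : ∀ {A B : Set} (f : A → List B) {L} → (∀ x → length (f x) ≤ L)
  → ∀ xs → length (concatMap f xs) ≤ length xs * L
length-concatMap-≤ f f≤L []       = z≤n
length-concatMap-≤ f f≤L (x ∷ xs) =
  ≤-trans (≤-reflexive (length-++ (f x))) (+-mono-≤ (f≤L x) (length-concatMap-≤ f f≤L xs))

lookup-injective : ∀ {A : Set} {xs : List A} → Unique xs → ∀ {i j} → lookup xs i ≡ lookup xs j → i ≡ j
lookup-injective (x∉xs ∷ u) {zero}  {zero}  eq = refl
lookup-injective (x∉xs ∷ u) {zero}  {suc j} eq = ⊥-elim (All.lookup x∉xs (∈-lookup j) eq)
lookup-injective (x∉xs ∷ u) {suc i} {zero}  eq = ⊥-elim (All.lookup x∉xs (∈-lookup i) (sym eq))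
lookup-injective (x∉xs ∷ u) {suc i} {suc j} eq = cong suc (lookup-injective u eq)

Σ< : ℕ → (ℕ → ℕ) → ℕ
Σ< zero    f = 0
Σ< (suc T) f = Σ< T f + f T

Σ<-mono-≤ : ∀ T {f g : ℕ → ℕ} → (∀ t → f t ≤ g t) → Σ< T f ≤ Σ< T g
Σ<-mono-≤ zero    f≤g = z≤n
Σ<-mono-≤ (suc T) f≤g = +-mono-≤ (Σ<-mono-≤ T f≤g) (f≤g T)

Σ<-+ : ∀ T (f g : ℕ → ℕ) → Σ< T (λ t → f t + g t) ≡ Σ< T f + Σ< T g
Σ<-+ zero    f g = refl
Σ<-+ (suc T) f g rewrite Σ<-+ T f g = ℕ-CS.interchange (Σ< T f) (Σ< T g) (f T) (g T)

Σ<-≡0 : ∀ T {f : ℕ → ℕ} → (∀ t → t < T → f t ≡ 0) → Σ< T f ≡ 0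
Σ<-≡0 zero    f≡0 = refl
Σ<-≡0 (suc T) f≡0 = cong₂ _+_ (Σ<-≡0 T (λ t t<T → f≡0 t (m<n⇒m<1+n t<T))) (f≡0 T (n<1+n T))

δ : ∀ {P : Set} → Dec P → ℕ
δ p = if does p then 1 else 0

δ-yes : ∀ {P : Set} (p : Dec P) → P → δ p ≡ 1
δ-yes p x rewrite dec-true p x = refl

δ-no : ∀ {P : Set} (p : Dec P) → ¬ P → δ p ≡ 0
δ-no p ¬x rewrite dec-false p ¬x = refl

Σ<-δ≤1 : ∀ T u → Σ< T (λ t → δ (u ≟ t)) ≤ 1
Σ<-δ≤1 zero    u = z≤n
Σ<-δ≤1 (suc T) u with u ≟ T
... | yes refl = ≤-reflexive (cong₂ _+_ (Σ<-≡0 T (λ t t<u → δ-no (u ≟ t) (>⇒≢ t<u))) (δ-yes (u ≟ u) refl))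
... | no  u≢T  = begin
  Σ< T (λ t → δ (u ≟ t)) + δ (u ≟ T)  ≡⟨ cong (Σ< T (λ t → δ (u ≟ t)) +_) (δ-no (u ≟ T) u≢T) ⟩
  Σ< T (λ t → δ (u ≟ t)) + 0          ≡⟨ +-identityʳ _ ⟩
  Σ< T (λ t → δ (u ≟ t))              ≤⟨ Σ<-δ≤1 T u ⟩
  1                                   ∎
  where open ≤-Reasoning

length-filter-∷ : ∀ {A : Set} {P : A → Set} (P? : ∀ x → Dec (P x)) x xs
  → length (filter P? (x ∷ xs)) ≡ δ (P? x) + length (filter P? xs)
length-filter-∷ P? x xs with does (P? x)
... | true  = refl
... | false = refl

Σ<-length-filter-≤ : ∀ {A : Set} (a : A → ℕ) xs T
  → Σ< T (λ t → length (filter (λ x → a x ≟ t) xs)) ≤ length xs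
Σ<-length-filter-≤ a []       T = ≤-reflexive (Σ<-≡0 T (λ _ _ → refl))
Σ<-length-filter-≤ a (x ∷ xs) T = begin
  Σ< T (λ t → length (filter (λ y → a y ≟ t) (x ∷ xs)))
    ≤⟨ Σ<-mono-≤ T (λ t → ≤-reflexive (length-filter-∷ (λ y → a y ≟ t) x xs)) ⟩
  Σ< T (λ t → δ (a x ≟ t) + length (filter (λ y → a y ≟ t) xs))
    ≡⟨ Σ<-+ T (λ t → δ (a x ≟ t)) _ ⟩
  Σ< T (λ t → δ (a x ≟ t)) + Σ< T (λ t → length (filter (λ y → a y ≟ t) xs))
    ≤⟨ +-mono-≤ (Σ<-δ≤1 T (a x)) (Σ<-length-filter-≤ a xs T) ⟩
  suc (length xs) ∎
  where open ≤-Reasoning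

-- Row v of column j, with the top cell R[j] replaced by R[s].
cell : ∀ {m n} → Fin (suc n) → Fin (suc n) → Fin (suc m) → Pos m n
cell s j zero    = zero , s
cell s j (suc b) = suc b , j

cell-nonzero : ∀ {m n} {s j : Fin (suc n)} {v : Fin (suc m)} → v ≢ zero → cell s j v ≡ (v , j)
cell-nonzero {v = zero}  v≢0 = ⊥-elim (v≢0 refl)
cell-nonzero {v = suc b} v≢0 = refl

cell-top-irrelevant : ∀ {m n} {s₁ s₂ j : Fin (suc n)} {v : Fin (suc m)} → v ≢ zero → cell s₁ j v ≡ cell s₂ j v
cell-top-irrelevant v≢0 = trans (cell-nonzero v≢0) (sym (cell-nonzero v≢0))

module Sweep {m n k : ℕ} (k≤n : k ≤ suc n) (σ : Fin k → Fin (suc n))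
             (σ-injective : ∀ {i₁ i₂} → σ i₁ ≡ σ i₂ → i₁ ≡ i₂) (d : Dir) where

  col : Fin k → Fin (suc n)
  col i = inject≤ i k≤n

  col-injective : ∀ {i₁ i₂} → col i₁ ≡ col i₂ → i₁ ≡ i₂
  col-injective = inject≤-injective k≤n k≤n _ _

  vcell : Fin k → Fin (suc m) → Pos m n
  vcell i = cell (σ i) (col i)

  -- after fireTime i rotations of R, the element of R[σ i] is on top of column col i
  fireTime : Fin k → ℕ
  fireTime i = gap (σ i) (col i)

  firing : ℕ → List (Fin (suc n))
  firing t = map col (filter (λ i → fireTime i ≟ t) (allFin k))

  fire : ℕ → List (Move (suc n))
  fire t = concatMap (colOp m d) (firing t)

  sweep : ℕ → List (Move (suc n))
  sweep zero    = []
  sweep (suc t) = sweep t ++ fire t ++ rowR ∷ []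

  Untouched : Pos m n → Set
  Untouched (zero  , s) = ∀ i → σ i ≢ s
  Untouched (suc b , j) = ∀ i → col i ≢ j

  vcell-injectiveˡ : ∀ {i₁ i₂ v₁ v₂} → vcell i₁ v₁ ≡ vcell i₂ v₂ → i₁ ≡ i₂
  vcell-injectiveˡ {v₁ = zero}  {zero}  eq = σ-injective (cong proj₂ eq)
  vcell-injectiveˡ {v₁ = suc _} {suc _} eq = col-injective (cong proj₂ eq)

  untouched-≢-vcell : ∀ {p} → Untouched p → ∀ i v → p ≢ vcell i v
  untouched-≢-vcell {zero  , s} σ≢s i zero    refl = σ≢s i refl
  untouched-≢-vcell {suc b , j} col≢j i (suc _) refl = col≢j i refl

  fire-at : ∀ {i t} r → fireTime i ≡ t → dests (fire t) (r , col i) ≡ (shift d r , col i)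
  fire-at {i} r eq = dests-colOps-∈ d r (map⁺ col-injective (filter⁺ _ (allFin⁺ k)))
                       (∈-map⁺ col (∈-filter⁺ _ (∈-allFin i) eq))

  fire-elsewhere : ∀ {t j} r → (∀ i → fireTime i ≡ t → col i ≢ j) → dests (fire t) (r , j) ≡ (r , j)
  fire-elsewhere {t} r quiet = dests-colOps-∉ d r j∉firing
    where
      j∉firing : _ ∉ firing t
      j∉firing j∈ with ∈-map⁻ col j∈
      ... | i , i∈ , refl = quiet i (proj₂ (∈-filter⁻ _ {xs = allFin k} i∈)) refl

  arrives-from-σ : ∀ {i t s} → fireTime i ≡ t → csucⁿ t s ≡ col i → s ≡ σ i
  arrives-from-σ {i} refl eq = csucⁿ-injective (fireTime i) (trans eq (sym (csucⁿ-gap (σ i) (col i))))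

  rotate-vcell-at-fireTime : ∀ {i t} v → fireTime i ≡ t → rotate t (vcell i v) ≡ (v , col i)
  rotate-vcell-at-fireTime {i} zero refl = trans (rotate-top (fireTime i) (σ i)) (cong (zero ,_) (csucⁿ-gap (σ i) (col i)))
  rotate-vcell-at-fireTime {i} {t} (suc b) _ = rotate-body t b (col i)

  fire-quiet : ∀ t p → (∀ i v → fireTime i ≡ t → p ≢ vcell i v) → dests (fire t) (rotate t p) ≡ rotate t p
  fire-quiet t (zero , s) quiet = begin
    dests (fire t) (rotate t (zero , s))  ≡⟨ cong (dests (fire t)) (rotate-top t s) ⟩
    dests (fire t) (zero , csucⁿ t s)
      ≡⟨ fire-elsewhere zero (λ i eq col≡ → quiet i zero eq (cong (zero ,_) (arrives-from-σ eq (sym col≡)))) ⟩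
    (zero , csucⁿ t s)                    ≡⟨ rotate-top t s ⟨
    rotate t (zero , s)                   ∎
    where open ≡-Reasoning
  fire-quiet t (suc b , j) quiet = begin
    dests (fire t) (rotate t (suc b , j))  ≡⟨ cong (dests (fire t)) (rotate-body t b j) ⟩
    dests (fire t) (suc b , j)
      ≡⟨ fire-elsewhere (suc b) (λ i eq col≡ → quiet i (suc b) eq (cong (suc b ,_) (sym col≡))) ⟩
    (suc b , j)                            ≡⟨ rotate-body t b j ⟨
    rotate t (suc b , j)                   ∎
    where open ≡-Reasoning

  dests-sweep-suc : ∀ t (p : Pos m n) → dests (sweep (suc t)) p ≡ dest rowR (dests (fire t) (dests (sweep t) p))
  dests-sweep-suc t p = trans (dests-++ (sweep t) _ p) (dests-++ (fire t) _ _)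

  sweep-before : ∀ {i} v t → t ≤ fireTime i → dests (sweep t) (vcell i v) ≡ rotate t (vcell i v)
  sweep-before v zero    _  = refl
  sweep-before {i} v (suc t) t<fi = begin
    dests (sweep (suc t)) (vcell i v)                    ≡⟨ dests-sweep-suc t _ ⟩
    dest rowR (dests (fire t) (dests (sweep t) (vcell i v)))
      ≡⟨ cong (dest rowR ∘ dests (fire t)) (sweep-before v t (<⇒≤ t<fi)) ⟩
    dest rowR (dests (fire t) (rotate t (vcell i v)))    ≡⟨ cong (dest rowR) (fire-quiet t _ quiet) ⟩
    dest rowR (rotate t (vcell i v))                     ∎
    where
      open ≡-Reasoning
      quiet : ∀ i₂ v₂ → fireTime i₂ ≡ t → vcell i v ≢ vcell i₂ v₂
      quiet i₂ v₂ eq same = <⇒≢ t<fi (sym (trans (cong fireTime (vcell-injectiveˡ same)) eq))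

  sweep-after : ∀ {i} v t → fireTime i < t → dests (sweep t) (vcell i v) ≡ rotate t (vcell i (shift d v))
  sweep-after {i} v (suc t) fi<1+t with m≤n⇒m<n∨m≡n (≤-pred fi<1+t)
  ... | inj₁ fi<t = begin
    dests (sweep (suc t)) (vcell i v)                    ≡⟨ dests-sweep-suc t _ ⟩
    dest rowR (dests (fire t) (dests (sweep t) (vcell i v)))
      ≡⟨ cong (dest rowR ∘ dests (fire t)) (sweep-after v t fi<t) ⟩
    dest rowR (dests (fire t) (rotate t (vcell i (shift d v))))  ≡⟨ cong (dest rowR) (fire-quiet t _ quiet) ⟩
    dest rowR (rotate t (vcell i (shift d v)))           ∎
    where
      open ≡-Reasoning
      quiet : ∀ i₂ v₂ → fireTime i₂ ≡ t → vcell i (shift d v) ≢ vcell i₂ v₂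
      quiet i₂ v₂ eq same = <⇒≢ fi<t (trans (cong fireTime (vcell-injectiveˡ same)) eq)
  ... | inj₂ fi≡t = begin
    dests (sweep (suc t)) (vcell i v)                    ≡⟨ dests-sweep-suc t _ ⟩
    dest rowR (dests (fire t) (dests (sweep t) (vcell i v)))
      ≡⟨ cong (dest rowR ∘ dests (fire t)) (sweep-before v t (≤-reflexive (sym fi≡t))) ⟩
    dest rowR (dests (fire t) (rotate t (vcell i v)))    ≡⟨ cong (dest rowR ∘ dests (fire t)) (rotate-vcell-at-fireTime v fi≡t) ⟩
    dest rowR (dests (fire t) (v , col i))               ≡⟨ cong (dest rowR) (fire-at v fi≡t) ⟩
    dest rowR (shift d v , col i)                        ≡⟨ cong (dest rowR) (rotate-vcell-at-fireTime (shift d v) fi≡t) ⟨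
    dest rowR (rotate t (vcell i (shift d v)))           ∎
    where open ≡-Reasoning

  sweep-untouched : ∀ {p} t → Untouched p → dests (sweep t) p ≡ rotate t p
  sweep-untouched zero    _ = refl
  sweep-untouched {p} (suc t) u = begin
    dests (sweep (suc t)) p                    ≡⟨ dests-sweep-suc t p ⟩
    dest rowR (dests (fire t) (dests (sweep t) p))  ≡⟨ cong (dest rowR ∘ dests (fire t)) (sweep-untouched t u) ⟩
    dest rowR (dests (fire t) (rotate t p))    ≡⟨ cong (dest rowR) (fire-quiet t p (λ i v _ → untouched-≢-vcell u i v)) ⟩
    dest rowR (rotate t p)                     ∎
    where open ≡-Reasoning

  sweep-cycles : ∀ i v → dests (sweep (suc n)) (vcell i v) ≡ vcell i (shift d v)
  sweep-cycles i v = trans (sweep-after v (suc n) (gap<N (σ i) (col i))) (rotate-period _)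

  sweep-fixes : ∀ {p} → Untouched p → dests (sweep (suc n)) p ≡ p
  sweep-fixes u = trans (sweep-untouched (suc n) u) (rotate-period _)

  firingCount : ℕ → ℕ
  firingCount t = length (filter (λ i → fireTime i ≟ t) (allFin k))

  length-fire : ∀ t → length (fire t) ≤ firingCount t * suc m
  length-fire t = begin
    length (fire t)                 ≤⟨ length-concatMap-≤ (colOp m d) (length-colOp m d) (firing t) ⟩
    length (firing t) * suc m       ≡⟨ cong (_* suc m) (length-map col (filter (λ i → fireTime i ≟ t) (allFin k))) ⟩
    firingCount t * suc m           ∎
    where open ≤-Reasoning

  length-sweep-≤ : ∀ T → length (sweep T) ≤ Σ< T firingCount * suc m + T
  length-sweep-≤ zero    = z≤n
  length-sweep-≤ (suc T) = begin
    length (sweep T ++ fire T ++ rowR ∷ [])           ≡⟨ length-++ (sweep T) ⟩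
    length (sweep T) + length (fire T ++ rowR ∷ [])   ≡⟨ cong (length (sweep T) +_) (length-++ (fire T)) ⟩
    length (sweep T) + (length (fire T) + 1)          ≤⟨ +-mono-≤ (length-sweep-≤ T) (+-monoˡ-≤ 1 (length-fire T)) ⟩
    Σ< T firingCount * suc m + T + (firingCount T * suc m + 1)
      ≡⟨ regroup (Σ< T firingCount) (firingCount T) (suc m) T ⟩
    (Σ< T firingCount + firingCount T) * suc m + suc T  ∎
    where
      open ≤-Reasoning
      regroup : ∀ a b c t → a * c + t + (b * c + 1) ≡ (a + b) * c + suc t
      regroup = solve-∀

  length-sweep : length (sweep (suc n)) ≤ k * suc m + suc n
  length-sweep = begin
    length (sweep (suc n))                        ≤⟨ length-sweep-≤ (suc n) ⟩
    Σ< (suc n) firingCount * suc m + suc n        ≤⟨ +-monoˡ-≤ (suc n) (*-monoˡ-≤ (suc m) fired≤k) ⟩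
    k * suc m + suc n                             ∎
    where
      open ≤-Reasoning
      fired≤k : Σ< (suc n) firingCount ≤ k
      fired≤k = ≤-trans (Σ<-length-filter-≤ fireTime (allFin k) (suc n)) (≤-reflexive (length-tabulate (λ i → i)))

target-body-< : ∀ {m n k} {π : Fin n → Fin n} d {b : Fin (suc m)} {j : Fin n}
  → toℕ j < k → target π k d (suc b , j) ≡ (bodyShift d (suc b) , j)
target-body-< {k = k} d {j = j} j<k rewrite dec-true (toℕ j <? k) j<k = refl

target-body-≮ : ∀ {m n k} {π : Fin n → Fin n} d {b : Fin (suc m)} {j : Fin n}
  → ¬ toℕ j < k → target π k d (suc b , j) ≡ (suc b , j)
target-body-≮ {k = k} d {j = j} j≮k rewrite dec-false (toℕ j <? k) j≮k = refl

module Construction (m n : ℕ) (π : Fin (suc (suc n)) → Fin (suc (suc n))) (π-involutive : Involution π) (d : Dir) where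

  N : ℕ
  N = suc (suc n)

  π-injective : ∀ {j₁ j₂} → π j₁ ≡ π j₂ → j₁ ≡ j₂
  π-injective {j₁} {j₂} eq = trans (sym (π-involutive j₁)) (trans (cong π eq) (π-involutive j₂))

  isStart? : ∀ j → Dec ((j F.< π j) × (π (π j) ≡ j))
  isStart? j = (j F.<? π j) ×-dec (π (π j) ≟ᶠ j)

  starts : List (Fin N)
  starts = filter isStart? (allFin N)

  k : ℕ
  k = a2 π

  k≤N : k ≤ N
  k≤N = ≤-trans (length-filter isStart? (allFin N)) (≤-reflexive (length-tabulate (λ j → j)))

  src : Fin k → Fin N
  src = lookup starts

  partner : Fin k → Fin N
  partner i = π (src i)

  src-injective : ∀ {i₁ i₂} → src i₁ ≡ src i₂ → i₁ ≡ i₂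
  src-injective = lookup-injective (filter⁺ isStart? (allFin⁺ N))

  partner-injective : ∀ {i₁ i₂} → partner i₁ ≡ partner i₂ → i₁ ≡ i₂
  partner-injective = src-injective ∘ π-injective

  src<partner : ∀ i → toℕ (src i) < toℕ (partner i)
  src<partner i = proj₁ (proj₂ (∈-filter⁻ isStart? {xs = allFin N} (∈-lookup i)))

  src≢partner : ∀ {i₁ i₂} → src i₁ ≢ partner i₂
  src≢partner {i₁} {i₂} eq = <-asym partner₂<src₁ src₁<src₂
    where
      partner₂<src₁ : toℕ (src i₂) < toℕ (src i₁)
      partner₂<src₁ = subst (λ x → toℕ (src i₂) < toℕ x) (sym eq) (src<partner i₂)
      src₁<src₂ : toℕ (src i₁) < toℕ (src i₂)
      src₁<src₂ = subst (λ x → toℕ (src i₁) < toℕ x) (trans (cong π eq) (π-involutive (src i₂))) (src<partner i₁)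

  src-not-fixed : ∀ {i s} → π s ≡ s → src i ≢ s
  src-not-fixed {i} πs≡s refl = <-irrefl (cong toℕ (sym πs≡s)) (src<partner i)

  data RowCell : Fin N → Set where
    source    : ∀ i → RowCell (src i)
    partnerOf : ∀ i → RowCell (partner i)
    fixed     : ∀ {s} → π s ≡ s → RowCell s

  rowCell : ∀ s → RowCell s
  rowCell s with <-cmp (toℕ s) (toℕ (π s))
  ... | tri< s<πs _ _ = subst RowCell (sym (lookup-index s∈)) (source (index s∈))
    where s∈ = ∈-filter⁺ isStart? (∈-allFin s) (s<πs , π-involutive s)
  ... | tri≈ _ s≡πs _ = fixed (sym (toℕ-injective s≡πs))
  ... | tri> _ _ πs<s = subst RowCell (trans (cong π (sym (lookup-index πs∈))) (π-involutive s)) (partnerOf (index πs∈))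
    where
      πs<ππs : toℕ (π s) < toℕ (π (π s))
      πs<ππs = subst (λ x → toℕ (π s) < toℕ x) (sym (π-involutive s)) πs<s
      πs∈ = ∈-filter⁺ isStart? (∈-allFin (π s)) (πs<ππs , π-involutive (π s))

  module S₁ = Sweep {suc m} {suc n} k≤N src src-injective d
  module S₂ = Sweep {suc m} {suc n} k≤N partner partner-injective (opposite d)

  col : Fin k → Fin N
  col = S₁.col

  sweep₁ sweep₂ : Pos (suc m) (suc n) → Pos (suc m) (suc n)
  sweep₁ = dests (S₁.sweep N)
  sweep₂ = dests (S₂.sweep N)

  moves : List (Move N)
  moves = S₁.sweep N ++ S₂.sweep N ++ S₁.sweep N

  dests-moves : ∀ p → dests moves p ≡ sweep₁ (sweep₂ (sweep₁ p))
  dests-moves p = trans (dests-++ (S₁.sweep N) _ p) (dests-++ (S₂.sweep N) _ _)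

  fixed-by-both : ∀ {p} → S₁.Untouched p → S₂.Untouched p → dests moves p ≡ p
  fixed-by-both {p} u₁ u₂ = begin
    dests moves p                ≡⟨ dests-moves p ⟩
    sweep₁ (sweep₂ (sweep₁ p))   ≡⟨ cong (sweep₁ ∘ sweep₂) (S₁.sweep-fixes u₁) ⟩
    sweep₁ (sweep₂ p)            ≡⟨ cong sweep₁ (S₂.sweep-fixes u₂) ⟩
    sweep₁ p                     ≡⟨ S₁.sweep-fixes u₁ ⟩
    p                            ∎
    where open ≡-Reasoning

  src-untouched₂ : ∀ i → S₂.Untouched (zero , src i)
  src-untouched₂ i _ eq = src≢partner (sym eq)

  partner-untouched₁ : ∀ i → S₁.Untouched (zero , partner i)
  partner-untouched₁ i _ = src≢partner

  row-src : ∀ i → dests moves (zero , src i) ≡ (zero , partner i)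
  row-src i = begin
    dests moves (zero , src i)                   ≡⟨ dests-moves _ ⟩
    sweep₁ (sweep₂ (sweep₁ (S₁.vcell i zero)))   ≡⟨ cong (sweep₁ ∘ sweep₂) (S₁.sweep-cycles i zero) ⟩
    sweep₁ (sweep₂ (S₁.vcell i (shift d zero)))
      ≡⟨ cong (sweep₁ ∘ sweep₂) (cell-top-irrelevant (shift-zero≢zero d)) ⟩
    sweep₁ (sweep₂ (S₂.vcell i (shift d zero)))  ≡⟨ cong sweep₁ (S₂.sweep-cycles i _) ⟩
    sweep₁ (S₂.vcell i (shift (opposite d) (shift d zero)))
      ≡⟨ cong (sweep₁ ∘ S₂.vcell i) (shift-inverseˡ d zero) ⟩
    sweep₁ (zero , partner i)                    ≡⟨ S₁.sweep-fixes (partner-untouched₁ i) ⟩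
    (zero , partner i)                           ∎
    where open ≡-Reasoning

  row-partner : ∀ i → dests moves (zero , partner i) ≡ (zero , src i)
  row-partner i = begin
    dests moves (zero , partner i)                  ≡⟨ dests-moves _ ⟩
    sweep₁ (sweep₂ (sweep₁ (zero , partner i)))     ≡⟨ cong (sweep₁ ∘ sweep₂) (S₁.sweep-fixes (partner-untouched₁ i)) ⟩
    sweep₁ (sweep₂ (S₂.vcell i zero))               ≡⟨ cong sweep₁ (S₂.sweep-cycles i zero) ⟩
    sweep₁ (S₂.vcell i (shift (opposite d) zero))
      ≡⟨ cong sweep₁ (cell-top-irrelevant (shift-zero≢zero (opposite d))) ⟩
    sweep₁ (S₁.vcell i (shift (opposite d) zero))   ≡⟨ S₁.sweep-cycles i _ ⟩
    S₁.vcell i (shift d (shift (opposite d) zero))  ≡⟨ cong (S₁.vcell i) (shift-inverseʳ d zero) ⟩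
    (zero , src i)                                  ∎
    where open ≡-Reasoning

  row-fixed : ∀ {s} → π s ≡ s → dests moves (zero , s) ≡ (zero , s)
  row-fixed {s} πs≡s = fixed-by-both (λ _ → src-not-fixed πs≡s) (λ i eq → src-not-fixed πs≡s (src≡s i eq))
    where
      src≡s : ∀ i → partner i ≡ s → src i ≡ s
      src≡s i eq = trans (sym (π-involutive (src i))) (trans (cong π eq) πs≡s)

  body-shifted : ∀ i b → dests moves (suc b , col i) ≡ (bodyShift d (suc b) , col i)
  body-shifted i b with bodyShift-skips-top d b
  ... | inj₁ (wraps , zero↦) = begin
    dests moves (suc b , col i)                     ≡⟨ dests-moves _ ⟩
    sweep₁ (sweep₂ (sweep₁ (S₁.vcell i (suc b))))   ≡⟨ cong (sweep₁ ∘ sweep₂) (S₁.sweep-cycles i (suc b)) ⟩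
    sweep₁ (sweep₂ (S₁.vcell i (shift d (suc b))))  ≡⟨ cong (sweep₁ ∘ sweep₂ ∘ S₁.vcell i) wraps ⟩
    sweep₁ (sweep₂ (zero , src i))                  ≡⟨ cong sweep₁ (S₂.sweep-fixes (src-untouched₂ i)) ⟩
    sweep₁ (S₁.vcell i zero)                        ≡⟨ S₁.sweep-cycles i zero ⟩
    S₁.vcell i (shift d zero)                       ≡⟨ cell-nonzero (shift-zero≢zero d) ⟩
    (shift d zero , col i)                          ≡⟨ cong (_, col i) zero↦ ⟩
    (bodyShift d (suc b) , col i)                   ∎
    where open ≡-Reasoning
  ... | inj₂ stays = begin
    dests moves (suc b , col i)                     ≡⟨ dests-moves _ ⟩
    sweep₁ (sweep₂ (sweep₁ (S₁.vcell i (suc b))))   ≡⟨ cong (sweep₁ ∘ sweep₂) (S₁.sweep-cycles i (suc b)) ⟩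
    sweep₁ (sweep₂ (S₁.vcell i (shift d (suc b))))  ≡⟨ cong (sweep₁ ∘ sweep₂) (cell-top-irrelevant shifted≢0) ⟩
    sweep₁ (sweep₂ (S₂.vcell i (shift d (suc b))))  ≡⟨ cong sweep₁ (S₂.sweep-cycles i _) ⟩
    sweep₁ (S₂.vcell i (shift (opposite d) (shift d (suc b))))
      ≡⟨ cong (sweep₁ ∘ S₂.vcell i) (shift-inverseˡ d (suc b)) ⟩
    sweep₁ (S₁.vcell i (suc b))                     ≡⟨ S₁.sweep-cycles i (suc b) ⟩
    S₁.vcell i (shift d (suc b))                    ≡⟨ cell-nonzero shifted≢0 ⟩
    (shift d (suc b) , col i)                       ≡⟨ cong (_, col i) stays ⟩
    (bodyShift d (suc b) , col i)                   ∎
    where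
      open ≡-Reasoning
      shifted≢0 : shift d (suc b) ≢ zero
      shifted≢0 eq = bodyShift≢zero d b (trans (sym stays) eq)

  moves-target : ∀ (p : Pos (suc m) (suc n)) → dests moves p ≡ target π k d p
  moves-target (zero , s) with rowCell s
  ... | source i    = row-src i
  ... | partnerOf i = trans (row-partner i) (cong (zero ,_) (sym (π-involutive (src i))))
  ... | fixed πs≡s  = trans (row-fixed πs≡s) (cong (zero ,_) (sym πs≡s))
  moves-target (suc b , j) with toℕ j <? k
  ... | yes j<k = trans (subst (λ j → dests moves (suc b , j) ≡ (bodyShift d (suc b) , j)) col≡j (body-shifted i b))
                        (sym (target-body-< {π = π} d j<k))
    where
      i = fromℕ< j<k
      col≡j : col i ≡ j
      col≡j = toℕ-injective (trans (toℕ-inject≤ i k≤N) (toℕ-fromℕ< j<k))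
  ... | no j≮k = trans (fixed-by-both col≢j col≢j) (sym (target-body-≮ {π = π} d j≮k))
    where
      col≢j : ∀ i → col i ≢ j
      col≢j i refl = j≮k (subst (_< k) (sym (toℕ-inject≤ i k≤N)) (toℕ<n i))

  length-moves : length moves ≤ 3 * (k * suc (suc m) + N)
  length-moves = begin
    length (S₁.sweep N ++ S₂.sweep N ++ S₁.sweep N)
      ≡⟨ length-++ (S₁.sweep N) ⟩
    length (S₁.sweep N) + length (S₂.sweep N ++ S₁.sweep N)
      ≡⟨ cong (length (S₁.sweep N) +_) (length-++ (S₂.sweep N)) ⟩
    length (S₁.sweep N) + (length (S₂.sweep N) + length (S₁.sweep N))
      ≤⟨ +-mono-≤ S₁.length-sweep (+-mono-≤ S₂.length-sweep S₁.length-sweep) ⟩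
    bound + (bound + bound)
      ≡⟨ cong (λ x → bound + (bound + x)) (+-identityʳ bound) ⟨
    3 * bound ∎
    where
      open ≤-Reasoning
      bound = k * suc (suc m) + N

lemma8 : Σ ℕ λ c → 0 < c ×
           (∀ (m' n' : ℕ) (X : Set) (A : Matrix X (suc (suc m')) (suc (suc n')))
            → (∀ i j i' j' → A i j ≡ A i' j' → (i ≡ i') × (j ≡ j'))
            → (π : Fin (suc (suc n')) → Fin (suc (suc n'))) → Involution π
            → (d : Dir)
            → Σ (List (Move (suc (suc n')))) λ ms
                → length ms ≤ c * (a2 π * suc (suc m') + suc (suc n'))
                × (∀ i j → run ms A (proj₁ (target π (a2 π) d (i , j))) (proj₂ (target π (a2 π) d (i , j))) ≡ A i j))
-- The distinctness of the entries is not needed: the moves are tracked on positions.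
lemma8 = 3 , s≤s z≤n , λ m n X A _ π π-involutive d →
  let open Construction m n π π-involutive d in
  moves , length-moves ,
  λ i j → trans (cong (uncurry (run moves A)) (sym (moves-target (i , j)))) (run-dests moves A (i , j))
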